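{- Let $G,H$ be graphs with no isolated vertices, and let $P_G$, $P_H$, $P_{G\times H}$ be pleats of $G$, $H$ and $G\times H$ respectively. Then $P_{G\times H}\cong P_G\times P_H$.
   Context: A graph is a finite undirected graph, loops allowed, at most one edge between two vertices; a graph morphism is a vertex map preserving edges. A vertex is isolated if it has no neighbors. $N(u)$ is the set of vertices adjacent to $u$ ($u\in N(u)$ iff $u$ is looped). The product $G\times H$ has vertex set $V(G)\times V(H)$ and $(v_1,w_1)\text{ --- }(v_2,w_2)$ iff $v_1\text{ --- }v_2$ in $G$ and $w_1\text{ --- }w_2$ in $H$. The exponential graph $H^G$ has as vertices the set maps $V(G)\to V(H)$, with $f\text{ --- }g$ iff $f(v_1)\text{ --- }g(v_2)$ for every edge $v_1\text{ --- }v_2$ of $G$. Morphisms are homotopic if joined by a sequence of morphisms consecutive ones adjacent in $H^G$; graphs $G,H$ are homotopy equivalent if there are morphisms $f:G\to H$, $g:H\to G$ with $gf$, $fg$ homotopic to the identities. A graph is stiff if there are no two distinct vertices $v,w$ with $N(v)\subseteq N(w)$. A pleat of $G$ is a stiff graph homotopy equivalent to $G$. -}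

module Defs where

open import Data.Nat using (ℕ; _*_)
open import Data.Fin using (Fin)
open import Data.Fin.Properties using (*↔×)
open import Data.Bool using (Bool; true; _∧_)
open import Data.Product using (Σ; ∃; _×_; _,_; proj₁; proj₂)
open import Data.Product.Function.NonDependent.Propositional using (_×-↔_)
open import Data.Empty using (⊥)
open import Function using (_∘_; id)
open import Function.Bundles using (_↔_; Inverse)
open import Function.Properties.Inverse using (↔-trans; ↔-sym)
open import Relation.Binary.PropositionalEquality using (_≡_; _≢_)
open import Relation.Nullary using (¬_)
open import Relation.Binary.Construct.Closure.ReflexiveTransitive using (Star)

-- A finite undirected graph (loops allowed, at most one edge between two
-- vertices): a vertex type in bijection with Fin size, and a symmetric
-- Boolean adjacency.
record Graph : Set₁ where
  field
    V     : Set
    size  : ℕ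
    enum  : V ↔ Fin size
    adj   : V → V → Bool
    adj-sym : ∀ u v → adj u v ≡ adj v u

open Graph public

Edge : (G : Graph) → V G → V G → Set
Edge G u v = adj G u v ≡ true

NoIsolated : Graph → Set
NoIsolated G = ∀ v → ∃ λ u → Edge G v u

IsHom : (G H : Graph) → (V G → V H) → Set
IsHom G H f = ∀ u v → Edge G u v → Edge H (f u) (f v)

Hom : Graph → Graph → Set
Hom G H = Σ (V G → V H) (IsHom G H)

ExpAdj : (G H : Graph) → (V G → V H) → (V G → V H) → Set
ExpAdj G H f g = ∀ v₁ v₂ → Edge G v₁ v₂ → Edge H (f v₁) (g v₂)

Homotopic : (G H : Graph) → Hom G H → Hom G H → Set
Homotopic G H = Star (λ f g → ExpAdj G H (proj₁ f) (proj₁ g))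

idHom : (G : Graph) → Hom G G
idHom G = id , λ u v e → e

compHom : (G H K : Graph) → Hom H K → Hom G H → Hom G K
compHom G H K (g , hg) (f , hf) = (g ∘ f) , λ u v e → hg _ _ (hf u v e)

HomotopyEquivalent : Graph → Graph → Set
HomotopyEquivalent G H =
  Σ (Hom G H) λ f → Σ (Hom H G) λ g →
    Homotopic G G (compHom G H G g f) (idHom G) × Homotopic H H (compHom H G H f g) (idHom H)

NbhdSub : (G : Graph) → V G → V G → Set
NbhdSub G v w = ∀ u → Edge G v u → Edge G w u

Stiff : Graph → Set
Stiff G = ∀ v w → v ≢ w → ¬ NbhdSub G v w

IsPleat : Graph → Graph → Set
IsPleat G P = Stiff P × HomotopyEquivalent G P

_⊗_ : Graph → Graph → Graph
G ⊗ H = record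
  { V = V G × V H
  ; size = size G * size H
  ; enum = ↔-trans (enum G ×-↔ enum H) (↔-sym *↔×)
  ; adj = λ p q → adj G (proj₁ p) (proj₁ q) ∧ adj H (proj₂ p) (proj₂ q)
  ; adj-sym = λ p q → sym-∧ (adj-sym G (proj₁ p) (proj₁ q)) (adj-sym H (proj₂ p) (proj₂ q))
  }
  where
  sym-∧ : ∀ {a b c d : Bool} → a ≡ c → b ≡ d → (a ∧ b) ≡ (c ∧ d)
  sym-∧ _≡_.refl _≡_.refl = _≡_.refl

record _≅_ (G H : Graph) : Set where
  field
    bij : V G ↔ V H
    edge-iff : ∀ u v →
      (Edge G u v → Edge H (Inverse.to bij u) (Inverse.to bij v)) ×
      (Edge H (Inverse.to bij u) (Inverse.to bij v) → Edge G u v)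

module Submission where

-- The proof rests on one rigidity fact: in a stiff graph P, an endomorphism
-- joined to the identity by a walk in the exponential graph P^P IS the
-- identity (a step f --- id gives N(v) ⊆ N(f v), so f v = v by stiffness).
-- Consequently two stiff graphs that are homotopy equivalent are isomorphic:
-- both composites of the equivalence are the identity, and the maps preserve
-- edges in both directions.
--
-- Then P_{G×H} ≃ G × H ≃ P_G × P_H,
-- both ends are stiff, and rigidity turns the equivalence into the
-- isomorphism P_{G×H} ≅ P_G × P_H.

open import Defs
open import Data.Bool using (true; _∧_)
import Data.Fin as Fin
open import Data.Product using (_×_; _,_; proj₁; proj₂; map)
open import Function using (_∘_; id)
open import Function.Bundles using (mk↔ₛ′)
open import Function.Properties.Inverse using (↔⇒↣)
open import Relation.Binary.PropositionalEquality
  using (_≡_; refl; sym; subst; subst₂)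
open import Relation.Binary.Definitions using (DecidableEquality)
open import Relation.Nullary using (yes; no; contradiction)
open import Relation.Nullary.Decidable using (via-injection)
open import Relation.Binary.Construct.Closure.ReflexiveTransitive
  using (Star; ε; _◅_; _◅◅_; gmap)

∧-split : ∀ {a b} → a ∧ b ≡ true → (a ≡ true) × (b ≡ true)
∧-split {true} {true} refl = refl , refl

∧-intro : ∀ {a b} → a ≡ true → b ≡ true → a ∧ b ≡ true
∧-intro refl refl = refl

-- Vertices of a graph have decidable equality, transported from Fin along
-- the enumeration; this is what makes the stiffness argument constructive.
vertex-≟ : (G : Graph) → DecidableEquality (V G)
vertex-≟ G = via-injection (↔⇒↣ (enum G)) Fin._≟_

-- A walk from f to g in the exponential graph B^A, forgetting whether the
-- intermediate maps are morphisms.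
Walk : (A B : Graph) → (V A → V B) → (V A → V B) → Set
Walk A B = Star (ExpAdj A B)

homotopic⇒walk : (A B : Graph) {f g : Hom A B} →
                 Homotopic A B f g → Walk A B (proj₁ f) (proj₁ g)
homotopic⇒walk A B = gmap proj₁ id

-- Adjacency in exponential graphs is compatible with composition and with
-- products.  Note that IsHom A B f is exactly ExpAdj A B f f.
expAdj-∘ : (A B C : Graph) {h h′ : V B → V C} {k k′ : V A → V B} →
           ExpAdj B C h h′ → ExpAdj A B k k′ → ExpAdj A C (h ∘ k) (h′ ∘ k′)
expAdj-∘ A B C h~h′ k~k′ u v e = h~h′ _ _ (k~k′ u v e)

expAdj-× : (A B C D : Graph) {f f′ : V A → V B} {g g′ : V C → V D} →
           ExpAdj A B f f′ → ExpAdj C D g g′ →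
           ExpAdj (A ⊗ C) (B ⊗ D) (map f g) (map f′ g′)
expAdj-× A B C D f~f′ g~g′ (a , c) (a′ , c′) e =
  let (eA , eC) = ∧-split {adj A a a′} e in ∧-intro (f~f′ _ _ eA) (g~g′ _ _ eC)

walk-whisker : (Z A B C : Graph) {α β : V A → V B} {h : V B → V C} {k : V Z → V A} →
               IsHom B C h → Walk A B α β → IsHom Z A k →
               Walk Z C (h ∘ α ∘ k) (h ∘ β ∘ k)
walk-whisker Z A B C {h = h} {k} h-hom α~β k-hom =
  gmap (λ α → h ∘ α ∘ k) (λ α~α′ → expAdj-∘ Z A C (expAdj-∘ A B C h-hom α~α′) k-hom) α~β

-- Walks in both factors combine to a walk of the product map: first move the
-- left factor (keeping the morphism g), then the right one (keeping f′).
walk-× : (A B C D : Graph) {f f′ : V A → V B} {g g′ : V C → V D} →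
         Walk A B f f′ → IsHom A B f′ → Walk C D g g′ → IsHom C D g →
         Walk (A ⊗ C) (B ⊗ D) (map f g) (map f′ g′)
walk-× A B C D {f′ = f′} {g = g} f~f′ f′-hom g~g′ g-hom =
  gmap (λ f → map f g) (λ f~f₁ → expAdj-× A B C D f~f₁ g-hom) f~f′ ◅◅
  gmap (λ g → map f′ g) (λ g~g₁ → expAdj-× A B C D f′-hom g~g₁) g~g′

-- Homotopy equivalence with walks of vertex maps as homotopies; unlike
-- HomotopyEquivalent it is closed under composition and products without
-- bookkeeping of morphism proofs along the homotopies.
record _≃_ (A B : Graph) : Set where
  field
    to       : V A → V B
    from     : V B → V A
    to-hom   : IsHom A B to
    from-hom : IsHom B A from
    from∘to  : Walk A A (from ∘ to) id
    to∘from  : Walk B B (to ∘ from) id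

open _≃_

homotopyEquivalent⇒≃ : (A B : Graph) → HomotopyEquivalent A B → A ≃ B
homotopyEquivalent⇒≃ A B ((f , f-hom) , (g , g-hom) , gf~id , fg~id) = record
  { to = f ; from = g ; to-hom = f-hom ; from-hom = g-hom
  ; from∘to = homotopic⇒walk A A gf~id ; to∘from = homotopic⇒walk B B fg~id }

≃-sym : {A B : Graph} → A ≃ B → B ≃ A
≃-sym e = record
  { to = from e ; from = to e ; to-hom = from-hom e ; from-hom = to-hom e
  ; from∘to = to∘from e ; to∘from = from∘to e }

-- g₁ g₂ f₂ f₁ ~ g₁ f₁ ~ id, by whiskering the middle homotopy.
≃-trans : {A B C : Graph} → A ≃ B → B ≃ C → A ≃ C
≃-trans {A} {B} {C} e₁ e₂ = record
  { to = to e₂ ∘ to e₁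
  ; from = from e₁ ∘ from e₂
  ; to-hom = expAdj-∘ A B C (to-hom e₂) (to-hom e₁)
  ; from-hom = expAdj-∘ C B A (from-hom e₁) (from-hom e₂)
  ; from∘to = walk-whisker A B B A (from-hom e₁) (from∘to e₂) (to-hom e₁) ◅◅ from∘to e₁
  ; to∘from = walk-whisker C B B C (to-hom e₂) (to∘from e₁) (from-hom e₂) ◅◅ to∘from e₂ }

-- Products of equivalences: (g × g′)(f × f′) = gf × g′f′ ~ id × id = id.
≃-× : {A B C D : Graph} → A ≃ B → C ≃ D → (A ⊗ C) ≃ (B ⊗ D)
≃-× {A} {B} {C} {D} e₁ e₂ = record
  { to = map (to e₁) (to e₂)
  ; from = map (from e₁) (from e₂)
  ; to-hom = expAdj-× A B C D (to-hom e₁) (to-hom e₂)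
  ; from-hom = expAdj-× B A D C (from-hom e₁) (from-hom e₂)
  ; from∘to = walk-× A A C C (from∘to e₁) (proj₂ (idHom A)) (from∘to e₂)
                     (expAdj-∘ C D C (from-hom e₂) (to-hom e₂))
  ; to∘from = walk-× B B D D (to∘from e₁) (proj₂ (idHom B)) (to∘from e₂)
                     (expAdj-∘ D C D (to-hom e₂) (from-hom e₂)) }

-- One step: if f --- g in P^P and g fixes every vertex, then N(v) ⊆ N(f v),
-- so stiffness forces f v = v.
stiff-step : (P : Graph) → Stiff P → {f g : V P → V P} →
             ExpAdj P P f g → (∀ v → g v ≡ v) → ∀ v → f v ≡ v
stiff-step P stiff {f} f~g g-fix v with vertex-≟ P (f v) v
... | yes fv≡v = fv≡v
... | no fv≢v  = contradiction N[v]⊆N[fv] (stiff v (f v) (fv≢v ∘ sym))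
  where
  N[v]⊆N[fv] : NbhdSub P v (f v)
  N[v]⊆N[fv] u e = subst (Edge P (f v)) (g-fix u) (f~g v u e)

stiff-rigid : (P : Graph) → Stiff P → {f g : V P → V P} →
              Walk P P f g → (∀ v → g v ≡ v) → ∀ v → f v ≡ v
stiff-rigid P stiff ε            g-fix = g-fix
stiff-rigid P stiff (f~h ◅ h~g) g-fix =
  stiff-step P stiff f~h (stiff-rigid P stiff h~g g-fix)

-- Homotopy equivalent stiff graphs are isomorphic: both composites are the
-- identity, and edges are reflected by applying the inverse morphism.
stiff-≃⇒≅ : {A B : Graph} → Stiff A → Stiff B → A ≃ B → A ≅ B
stiff-≃⇒≅ {A} {B} stiffA stiffB e = record
  { bij = mk↔ₛ′ (to e) (from e) to∘from≡id from∘to≡id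
  ; edge-iff = λ u v →
      to-hom e u v ,
      λ e′ → subst₂ (Edge A) (from∘to≡id u) (from∘to≡id v) (from-hom e _ _ e′) }
  where
  from∘to≡id : ∀ u → from e (to e u) ≡ u
  from∘to≡id = stiff-rigid A stiffA (from∘to e) (λ _ → refl)
  to∘from≡id : ∀ u → to e (from e u) ≡ u
  to∘from≡id = stiff-rigid B stiffB (to∘from e) (λ _ → refl)

-- A stiff graph homotopy equivalent to a graph without isolated vertices has
-- none: w = to (from w), and from w has a neighbour u, so to u --- w.
stiff-noIsolated : {A P : Graph} → Stiff P → A ≃ P → NoIsolated A → NoIsolated P
stiff-noIsolated {A} {P} stiff e noIsoA w =
  to e u ,
  subst (λ x → Edge P x (to e u)) (to∘from≡id w) (to-hom e _ _ from-w~u)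
  where
  u : V A
  u = proj₁ (noIsoA (from e w))
  from-w~u : Edge A (from e w) u
  from-w~u = proj₂ (noIsoA (from e w))
  to∘from≡id : ∀ v → to e (from e v) ≡ v
  to∘from≡id = stiff-rigid P stiff (to∘from e) (λ _ → refl)

-- A product of stiff graphs without isolated vertices is stiff: if
-- N(a,b) ⊆ N(a′,b′), pairing with a neighbour in the other factor shows
-- N(a) ⊆ N(a′) and N(b) ⊆ N(b′), so a = a′ and b = b′.
stiff-⊗ : (P Q : Graph) → Stiff P → Stiff Q → NoIsolated P → NoIsolated Q →
          Stiff (P ⊗ Q)
stiff-⊗ P Q stiffP stiffQ noIsoP noIsoQ (a , b) (a′ , b′) ab≢a′b′ N⊆N
  with vertex-≟ P a a′ | vertex-≟ Q b b′
... | yes refl | yes refl = ab≢a′b′ refl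
... | no a≢a′  | _        = stiffP a a′ a≢a′ N[a]⊆N[a′]
  where
  N[a]⊆N[a′] : NbhdSub P a a′
  N[a]⊆N[a′] x a~x =
    let (y , b~y) = noIsoQ b
    in proj₁ (∧-split {adj P a′ x} (N⊆N (x , y) (∧-intro a~x b~y)))
... | yes _    | no b≢b′  = stiffQ b b′ b≢b′ N[b]⊆N[b′]
  where
  N[b]⊆N[b′] : NbhdSub Q b b′
  N[b]⊆N[b′] y b~y =
    let (x , a~x) = noIsoP a
    in proj₂ (∧-split {adj P a′ x} (N⊆N (x , y) (∧-intro a~x b~y)))

theorem5p7 : (G H PG PH PGH : Graph) →
    NoIsolated G → NoIsolated H →
    IsPleat G PG → IsPleat H PH → IsPleat (G ⊗ H) PGH →
    PGH ≅ (PG ⊗ PH)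
theorem5p7 G H PG PH PGH noIsoG noIsoH
  (stiffPG , G≃PG) (stiffPH , H≃PH) (stiffPGH , G⊗H≃PGH) =
  stiff-≃⇒≅ stiffPGH stiffPG⊗PH PGH≃PG⊗PH
  where
  G≃PG′ : G ≃ PG
  G≃PG′ = homotopyEquivalent⇒≃ G PG G≃PG
  H≃PH′ : H ≃ PH
  H≃PH′ = homotopyEquivalent⇒≃ H PH H≃PH
  PGH≃PG⊗PH : PGH ≃ (PG ⊗ PH)
  PGH≃PG⊗PH = ≃-trans (≃-sym (homotopyEquivalent⇒≃ (G ⊗ H) PGH G⊗H≃PGH)) (≃-× G≃PG′ H≃PH′)
  stiffPG⊗PH : Stiff (PG ⊗ PH)
  stiffPG⊗PH = stiff-⊗ PG PH stiffPG stiffPH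
    (stiff-noIsolated stiffPG G≃PG′ noIsoG) (stiff-noIsolated stiffPH H≃PH′ noIsoH)
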